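{- For every $n\in\mathbb N$ (with $n\ge1$), $$\Delta(\zeta^f(2n+1))=\pi(\zeta^f(2n+1))\otimes\mathbf 1+\mathbf 1\otimes\zeta^f(2n+1)\in\mathcal A^f\otimes\mathcal Z^f.$$
   Context: Let $X=\{x_0,x_1\}$ and let $\mathbb Q\langle X\rangle$ be the free non-commutative $\mathbb Q$-algebra on $X$, with word basis and empty word $\mathbf 1$. Write $(f\mid w)$ for coefficients. Shuffle product: $\mathbf 1\sqcup\!\sqcup w=w\sqcup\!\sqcup\mathbf 1=w$ and $au\sqcup\!\sqcup bv=a(u\sqcup\!\sqcup bv)+b(au\sqcup\!\sqcup v)$. Stuffle product on $\mathbb Q\langle Y\rangle$, $Y=\{y_1,y_2,\dots\}$: $\mathbf 1*w=w*\mathbf 1=w$ and $y_iu*y_jv=y_i(u*y_jv)+y_j(y_iu*v)+y_{i+j}(u*v)$. Let $\iota(y_{k_1}\cdots y_{k_d})=x_0^{k_1-1}x_1\cdots x_0^{k_d-1}x_1$, $\mathfrak h^0=\mathbb Q\mathbf 1+x_0\mathbb Q\langle X\rangle x_1$ and $\mathfrak h^1=\mathbb Q\mathbf 1+\mathbb Q\langle X\rangle x_1$. $\mathcal Z^f=(\mathbb Q\langle X\rangle,\sqcup\!\sqcup)/R$, with $R$ the ideal generated by $x_0$, $x_1$ and all $u\sqcup\!\sqcup v-\iota(\iota^{ -1}(u)*\iota^{ -1}(v))$ ($u\in\mathfrak h^0$, $v\in\mathfrak h^1$). $\zeta^f$ is the projection and $\zeta^f(k)=\zeta^f(x_0^{k-1}x_1)$.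 $\mathcal A^f=\mathcal Z^f/(\zeta^f(2))$ with projection $\pi$; $\mathbf 1$ also denotes the unit of $\mathcal A^f$ and of $\mathcal Z^f$. Goncharov coproduct. Let $S(\varepsilon_1\cdots\varepsilon_n)=(-1)^n\varepsilon_n\cdots\varepsilon_1$. Set $I(a;f;b)=f$ if $(a,b)=(x_1,x_0)$, $S(f)$ if $(a,b)=(x_0,x_1)$, and $(f\mid\mathbf 1)\mathbf 1$ if $a=b$. With $\varepsilon_0=x_1$ and $\varepsilon_{n+1}=x_0$, $$\Delta_{\mathrm{Gon}}(\varepsilon_1\cdots\varepsilon_n)=\sum_{0=i_0<\dots<i_{k+1}=n+1}\Big(\mathop{\sqcup\!\sqcup}_{p=0}^k I(\varepsilon_{i_p};\varepsilon_{i_p+1}\cdots\varepsilon_{i_{p+1}-1};\varepsilon_{i_{p+1}})\Big)\otimes\varepsilon_{i_1}\cdots\varepsilon_{i_k}.$$ The coaction $\Delta:\mathcal Z^f\to\mathcal A^f\otimes\mathcal Z^f$ is $\Delta(\zeta^f(w))=(\pi\circ\zeta^f\otimes\zeta^f)(\Delta_{\mathrm{Gon}}(w))$; it is well defined, i.e. independent of the lift $w$. -}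

module Defs where

open import Data.Nat using (ℕ; zero; suc; _+_; _*_; _∸_; _≤_)
open import Data.Bool using (Bool; true; false; if_then_else_; _∧_)
open import Data.Unit using (⊤)
open import Data.List using (List; []; _∷_; _++_; map; concatMap; reverse; length; replicate)
open import Data.Product using (_×_; _,_; Σ)
open import Data.Rational using (ℚ; 0ℚ; 1ℚ; -_) renaming (_+_ to _+ℚ_; _*_ to _*ℚ_)
open import Relation.Binary.PropositionalEquality using (_≡_)

data X : Set where
  x0 x1 : X

Word : Set
Word = List X

eqX : X → X → Bool
eqX x0 x0 = true
eqX x1 x1 = true
eqX _  _  = false

eqW : Word → Word → Bool
eqW [] [] = true
eqW (a ∷ u) (b ∷ v) = eqX a b ∧ eqW u v
eqW _ _ = false

-- an element of Q<X> as a finite formal sum  Σ c·w  (equality = equal coefficients)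
Poly : Set
Poly = List (ℚ × Word)

-- an element of Q<X> ⊗ Q<X> as a finite formal sum  Σ c·(u ⊗ v)
Tens : Set
Tens = List (ℚ × Word × Word)

coeff : Poly → Word → ℚ
coeff [] w = 0ℚ
coeff ((c , u) ∷ p) w = (if eqW u w then c else 0ℚ) +ℚ coeff p w

coeff2 : Tens → Word → Word → ℚ
coeff2 [] a b = 0ℚ
coeff2 ((c , u , v) ∷ t) a b = (if eqW u a ∧ eqW v b then c else 0ℚ) +ℚ coeff2 t a b

one : Poly
one = (1ℚ , []) ∷ []

scale : ℚ → Poly → Poly
scale c = map (λ { (d , u) → (c *ℚ d , u) })

scaleT : ℚ → Tens → Tens
scaleT c = map (λ { (d , u , v) → (c *ℚ d , u , v) })

lmul : X → Poly → Poly
lmul a = map (λ { (d , u) → (d , a ∷ u) })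

sh : Word → Word → Poly
sh [] v = (1ℚ , v) ∷ []
sh (a ∷ u) [] = (1ℚ , a ∷ u) ∷ []
sh (a ∷ u) (b ∷ v) = lmul a (sh u (b ∷ v)) ++ lmul b (sh (a ∷ u) v)

shP : Poly → Poly → Poly
shP p q = concatMap (λ { (c , u) → concatMap (λ { (d , v) → scale (c *ℚ d) (sh u v) }) q }) p

-- Words in Y = {y1, y2, ...}: the letter k : ℕ encodes y_(k+1)

YWord : Set
YWord = List ℕ

YPoly : Set
YPoly = List (ℚ × YWord)

ly : ℕ → YPoly → YPoly
ly k = map (λ { (d , u) → (d , k ∷ u) })

-- stuffle;  y_(i+1) y_(j+1) ↦ y_(i+j+2), i.e. letter suc (i + j)
st : YWord → YWord → YPoly
st [] v = (1ℚ , v) ∷ []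
st (i ∷ u) [] = (1ℚ , i ∷ u) ∷ []
st (i ∷ u) (j ∷ v) = ly i (st u (j ∷ v)) ++ (ly j (st (i ∷ u) v) ++ ly (suc (i + j)) (st u v))

ι : YWord → Word
ι [] = []
ι (k ∷ u) = replicate k x0 ++ (x1 ∷ ι u)

ιP : YPoly → Poly
ιP = map (λ { (d , u) → (d , ι u) })

-- ι a ∈ 𝔥⁰ : a is empty or its first letter is y_k with k ≥ 2
Conv : YWord → Set
Conv [] = ⊤
Conv (k ∷ _) = 1 ≤ k

-- Generators of the ideal R (of 𝒵^f) and of R + (ζ^f(2)) (of 𝒜^f)

data GenZ : Set where
  gx0 gx1 : GenZ
  -- ι(a) ⧢ ι(b) − ι(a * b), with ι(a) ∈ 𝔥⁰ and ι(b) ∈ 𝔥¹ (words; spans by bilinearity)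
  gds : (a b : YWord) → Conv a → GenZ

genZ : GenZ → Poly
genZ gx0 = (1ℚ , x0 ∷ []) ∷ []
genZ gx1 = (1ℚ , x1 ∷ []) ∷ []
genZ (gds a b _) = sh (ι a) (ι b) ++ scale (- 1ℚ) (ιP (st a b))

data GenA : Set where
  fromZ : GenZ → GenA
  gz2 : GenA

genA : GenA → Poly
genA (fromZ g) = genZ g
genA gz2 = (1ℚ , x0 ∷ x1 ∷ []) ∷ []

-- spanning elements of  ker(π∘ζ^f ⊗ ζ^f) = R_A ⊗ Q<X> + Q<X> ⊗ R
-- (the shuffle ideal generated by G is spanned by the g ⧢ u, g ∈ G, u a word)
data KTerm : Set where
  kl : ℚ → GenA → Word → Word → KTerm
  kr : ℚ → Word → GenZ → Word → KTerm

evalK : KTerm → Tens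
evalK (kl c g u w) = map (λ { (d , v) → (d , v , w) }) (scale c (shP (genA g) ((1ℚ , u) ∷ [])))
evalK (kr c u g w) = map (λ { (d , v) → (d , u , v) }) (scale c (shP (genZ g) ((1ℚ , w) ∷ [])))

InKer : Tens → Set
InKer t = Σ (List KTerm) λ ks → ∀ a b → coeff2 t a b ≡ coeff2 (concatMap evalK ks) a b

-- (π∘ζ^f ⊗ ζ^f)(s) = (π∘ζ^f ⊗ ζ^f)(t)  in  𝒜^f ⊗ 𝒵^f
EqAZ : Tens → Tens → Set
EqAZ s t = InKer (s ++ scaleT (- 1ℚ) t)

sign : ℕ → ℚ
sign zero = 1ℚ
sign (suc k) = - sign k

I : X → Word → X → Poly
I x1 f x0 = (1ℚ , f) ∷ []
I x0 f x1 = (sign (length f) , reverse f) ∷ []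
I x0 [] x0 = one
I x1 [] x1 = one
I x0 (_ ∷ _) x0 = []
I x1 (_ ∷ _) x1 = []

tensR : Poly → Word → Tens
tensR p r = map (λ { (d , u) → (d , u , r) }) p

-- a : current left endpoint ε_(i_p); seg : letters since it; L : shuffle of
-- completed I-factors; R : selected letters so far; last argument : remaining letters
gonGo : X → Word → Poly → Word → Word → Tens
gonGo a seg L R [] = tensR (shP L (I a seg x0)) R
gonGo a seg L R (e ∷ rest) =
  gonGo a (seg ++ (e ∷ [])) L R rest ++ gonGo e [] (shP L (I a seg e)) (R ++ (e ∷ [])) rest

ΔGon : Word → Tens
ΔGon w = gonGo x1 [] one [] w

zetaWord : ℕ → Word
zetaWord k = replicate (k ∸ 1) x0 ++ (x1 ∷ [])

module Submission where

-- Every term of Δ_Gon(x0^(k-1) x1) other than w ⊗ 1 and 1 ⊗ w has as left factor a shuffle of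
-- factors I(x0; x0^m; x0) and I(x0; x0^m; x1) with at least one x0 in total, since a segment that
-- contains x1 and is bounded by x0 on both sides contributes I = 0.  As x0 ∈ R and
-- x0 ⧢ x0^m = (m+1)·x0^(m+1), every such term x0^(m+1) ⊗ v lies in the kernel of π∘ζ^f ⊗ ζ^f, so
-- only the two primitive terms survive.  Nothing depends on the parity of the weight k ≥ 2.

open import Defs
open import Data.Nat using (ℕ; zero; suc; _+_; _*_; _≤_; s≤s; z≤n)
open import Data.Nat.Properties using (≤-trans; +-monoˡ-≤; *-monoʳ-≤)
open import Data.List using (List; []; _∷_; _++_; _∷ʳ_; map; concatMap; replicate; length; reverse)
open import Data.List.Properties using (map-replicate; ++-identityʳ; ++-assoc; unfold-reverse)
open import Data.List.Relation.Unary.All as All using (All; []; _∷_)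
open import Data.List.Relation.Unary.All.Properties using (++⁺; map⁺; concat⁺)
open import Data.List.Relation.Unary.Any.Properties using (reverse⁻)
open import Data.Product using (Σ; _×_; _,_; proj₁; proj₂)
open import Data.Sum using (_⊎_; inj₁; inj₂)
open import Data.Bool using (true; false; _∧_; if_then_else_)
open import Data.Rational using (ℚ; 0ℚ; 1ℚ; -_; 1/_; NonZero; NonNegative) renaming (_+_ to _+ℚ_; _*_ to _*ℚ_)
open import Data.Rational.Properties
  using (+-*-ring; +-assoc; +-identityˡ; *-identityˡ; *-identityʳ; *-zeroʳ; *-distribˡ-+; *-inverseʳ;
         nonNeg+nonNeg⇒nonNeg; pos+nonNeg⇒pos; pos⇒nonZero)
open import Data.Rational.Solver using (module +-*-Solver)
open import Algebra.Bundles using (Ring)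
open import Algebra.Properties.Semiring.Mult (Ring.semiring +-*-ring) using (×-comm-*; ×-assoc-*) renaming (_×_ to _×ℚ_)
open import Relation.Binary.PropositionalEquality using (_≡_; refl; sym; trans; cong; cong₂; module ≡-Reasoning)
open import Function using (_∘_)

X0Power : Word → Set
X0Power = All (_≡ x0)

data NonEmpty : Word → Set where
  nonEmpty : ∀ {a u} → NonEmpty (a ∷ u)

X0Power⁺ : Word → Set
X0Power⁺ w = X0Power w × NonEmpty w

AllWords : (Word → Set) → Poly → Set
AllWords P = All (P ∘ proj₂)

Negligible : Tens → Set
Negligible = All (X0Power⁺ ∘ proj₁ ∘ proj₂)

X0Power-reverse : ∀ {u} → X0Power u → X0Power (reverse u)
X0Power-reverse p = All.tabulate (All.lookup p ∘ reverse⁻)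

NonEmpty-∷ʳ : ∀ u a → NonEmpty (u ∷ʳ a)
NonEmpty-∷ʳ []      a = nonEmpty
NonEmpty-∷ʳ (_ ∷ _) a = nonEmpty

NonEmpty-reverse : ∀ {u} → NonEmpty u → NonEmpty (reverse u)
NonEmpty-reverse {a ∷ u} nonEmpty rewrite unfold-reverse a u = NonEmpty-∷ʳ (reverse u) a

lmul-X0Power : ∀ {p} → AllWords X0Power p → AllWords X0Power (lmul x0 p)
lmul-X0Power = map⁺ ∘ All.map (refl ∷_)

lmul-NonEmpty : ∀ a p → AllWords NonEmpty (lmul a p)
lmul-NonEmpty a p = map⁺ (All.universal (λ _ → nonEmpty) p)

sh-X0Power : ∀ {u v} → X0Power u → X0Power v → AllWords X0Power (sh u v)
sh-X0Power {[]}             p q = q ∷ []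
sh-X0Power {_ ∷ _} {[]}     p q = p ∷ []
sh-X0Power {x0 ∷ u} {x0 ∷ v} (refl ∷ p) (refl ∷ q) =
  ++⁺ (lmul-X0Power (sh-X0Power p (refl ∷ q))) (lmul-X0Power (sh-X0Power (refl ∷ p) q))

sh-NonEmpty : ∀ u v → NonEmpty u ⊎ NonEmpty v → AllWords NonEmpty (sh u v)
sh-NonEmpty []      v       (inj₂ q) = q ∷ []
sh-NonEmpty (a ∷ u) []      _        = nonEmpty ∷ []
sh-NonEmpty (a ∷ u) (b ∷ v) _        = ++⁺ (lmul-NonEmpty a (sh u (b ∷ v))) (lmul-NonEmpty b (sh (a ∷ u) v))

shP-closed : ∀ {P Q R : Word → Set} → (∀ {u v} → Q u → R v → AllWords P (sh u v)) →
             ∀ {L M} → AllWords Q L → AllWords R M → AllWords P (shP L M)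
shP-closed sh-closed qL rM =
  concat⁺ (map⁺ (All.map (λ qu → concat⁺ (map⁺ (All.map (λ rv → map⁺ (sh-closed qu rv)) rM))) qL))

shP-X0Power⁺ˡ : ∀ {L M} → AllWords X0Power⁺ L → AllWords X0Power M → AllWords X0Power⁺ (shP L M)
shP-X0Power⁺ˡ = shP-closed λ {u} {v} (p , ne) q → All.zip (sh-X0Power p q , sh-NonEmpty u v (inj₁ ne))

shP-X0Power⁺ʳ : ∀ {L M} → AllWords X0Power L → AllWords X0Power⁺ M → AllWords X0Power⁺ (shP L M)
shP-X0Power⁺ʳ = shP-closed λ {u} {v} p (q , ne) → All.zip (sh-X0Power p q , sh-NonEmpty u v (inj₂ ne))

one-X0Power : AllWords X0Power one
one-X0Power = [] ∷ []

I-x0-x0-X0Power : ∀ seg → AllWords X0Power (I x0 seg x0)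
I-x0-x0-X0Power []      = one-X0Power
I-x0-x0-X0Power (_ ∷ _) = []

I-x0-x1-X0Power : ∀ {seg} → X0Power seg → AllWords X0Power (I x0 seg x1)
I-x0-x1-X0Power p = X0Power-reverse p ∷ []

I-x0-x1-X0Power⁺ : ∀ {seg} → X0Power⁺ seg → AllWords X0Power⁺ (I x0 seg x1)
I-x0-x1-X0Power⁺ (p , ne) = (X0Power-reverse p , NonEmpty-reverse ne) ∷ []

I-x0-∷ʳx1-x0 : ∀ seg → I x0 (seg ∷ʳ x1) x0 ≡ []
I-x0-∷ʳx1-x0 []      = refl
I-x0-∷ʳx1-x0 (_ ∷ _) = refl

tensR-negligible : ∀ {p} r → AllWords X0Power⁺ p → Negligible (tensR p r)
tensR-negligible r = map⁺

x0^_x1 : ℕ → Word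
x0^ k x1 = replicate k x0 ++ x1 ∷ []

-- Once the accumulated left factor L (ᴸ) or the open segment (ˢ) is a positive power of x0, so is
-- every left factor produced: the segment reaching x1 gives either I(x0; seg x1; x0) = 0 or the
-- x0-power I(x0; seg; x1).
gonGo-x0-negligibleᴸ : ∀ k {seg L} R → X0Power seg → AllWords X0Power⁺ L →
                       Negligible (gonGo x0 seg L R (x0^ k x1))
gonGo-x0-negligibleᴸ zero {seg} R p pL rewrite I-x0-∷ʳx1-x0 seg =
  ++⁺ (tensR-negligible R (shP-X0Power⁺ˡ pL []))
      (tensR-negligible (R ∷ʳ x1) (shP-X0Power⁺ˡ (shP-X0Power⁺ˡ pL (I-x0-x1-X0Power p)) one-X0Power))
gonGo-x0-negligibleᴸ (suc k) {seg} R p pL =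
  ++⁺ (gonGo-x0-negligibleᴸ k R (++⁺ p (refl ∷ [])) pL)
      (gonGo-x0-negligibleᴸ k (R ∷ʳ x0) [] (shP-X0Power⁺ˡ pL (I-x0-x0-X0Power seg)))

gonGo-x0-negligibleˢ : ∀ k {seg L} R → X0Power⁺ seg → AllWords X0Power L →
                       Negligible (gonGo x0 seg L R (x0^ k x1))
gonGo-x0-negligibleˢ zero {seg} R ps pL rewrite I-x0-∷ʳx1-x0 seg =
  ++⁺ (tensR-negligible R (shP-X0Power⁺ʳ pL []))
      (tensR-negligible (R ∷ʳ x1) (shP-X0Power⁺ˡ (shP-X0Power⁺ʳ pL (I-x0-x1-X0Power⁺ ps)) one-X0Power))
gonGo-x0-negligibleˢ (suc k) {a ∷ seg} R (p , nonEmpty) pL =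
  ++⁺ (gonGo-x0-negligibleˢ k R (++⁺ p (refl ∷ []) , nonEmpty) pL)
      (gonGo-x0-negligibleᴸ k (R ∷ʳ x0) [] (shP-X0Power⁺ʳ pL []))

infix 4 _≈_ _≈ₙ_

_≈_ : Tens → Tens → Set
s ≈ t = ∀ a b → coeff2 s a b ≡ coeff2 t a b

record _≈ₙ_ (t s : Tens) : Set where
  constructor modNegligible
  field
    residue    : Tens
    negligible : Negligible residue
    split      : t ≈ s ++ residue

coeff2-++ : ∀ s t a b → coeff2 (s ++ t) a b ≡ coeff2 s a b +ℚ coeff2 t a b
coeff2-++ []                t a b = sym (+-identityˡ _)
coeff2-++ ((c , u , v) ∷ s) t a b rewrite coeff2-++ s t a b =
  sym (+-assoc (if eqW u a ∧ eqW v b then c else 0ℚ) (coeff2 s a b) (coeff2 t a b))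

≈ₙ-++ : ∀ {t₁ t₂ s₁ s₂} → t₁ ≈ₙ s₁ → t₂ ≈ₙ s₂ → t₁ ++ t₂ ≈ₙ s₁ ++ s₂
≈ₙ-++ {t₁} {t₂} {s₁} {s₂} (modNegligible g₁ n₁ e₁) (modNegligible g₂ n₂ e₂) =
  modNegligible (g₁ ++ g₂) (++⁺ n₁ n₂) λ a b → begin
  coeff2 (t₁ ++ t₂) a b                                  ≡⟨ coeff2-++ t₁ t₂ a b ⟩
  coeff2 t₁ a b +ℚ coeff2 t₂ a b                         ≡⟨ cong₂ _+ℚ_ (e₁ a b) (e₂ a b) ⟩
  coeff2 (s₁ ++ g₁) a b +ℚ coeff2 (s₂ ++ g₂) a b         ≡⟨ cong₂ _+ℚ_ (coeff2-++ s₁ g₁ a b) (coeff2-++ s₂ g₂ a b) ⟩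
  (coeff2 s₁ a b +ℚ coeff2 g₁ a b) +ℚ (coeff2 s₂ a b +ℚ coeff2 g₂ a b)
    ≡⟨ interchange (coeff2 s₁ a b) (coeff2 g₁ a b) (coeff2 s₂ a b) (coeff2 g₂ a b) ⟩
  (coeff2 s₁ a b +ℚ coeff2 s₂ a b) +ℚ (coeff2 g₁ a b +ℚ coeff2 g₂ a b)
    ≡⟨ cong₂ _+ℚ_ (coeff2-++ s₁ s₂ a b) (coeff2-++ g₁ g₂ a b) ⟨
  coeff2 (s₁ ++ s₂) a b +ℚ coeff2 (g₁ ++ g₂) a b         ≡⟨ coeff2-++ (s₁ ++ s₂) (g₁ ++ g₂) a b ⟨
  coeff2 ((s₁ ++ s₂) ++ (g₁ ++ g₂)) a b                  ∎
  where
  open ≡-Reasoning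
  open +-*-Solver
  interchange : ∀ p q r s → (p +ℚ q) +ℚ (r +ℚ s) ≡ (p +ℚ r) +ℚ (q +ℚ s)
  interchange = solve 4 (λ p q r s → (p :+ q) :+ (r :+ s) := (p :+ r) :+ (q :+ s)) refl

negligible⇒≈ₙ[] : ∀ {t} → Negligible t → t ≈ₙ []
negligible⇒≈ₙ[] {t} n = modNegligible t n λ a b → refl

gonGo-x0-≈ₙ-𝟙⊗word : ∀ k R → gonGo x0 [] one R (x0^ k x1) ≈ₙ (1ℚ , [] , R ++ x0^ k x1) ∷ []
gonGo-x0-≈ₙ-𝟙⊗word zero    R = modNegligible [] [] λ a b → refl
gonGo-x0-≈ₙ-𝟙⊗word (suc k) R rewrite sym (++-assoc R (x0 ∷ []) (x0^ k x1)) =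
  ≈ₙ-++ (negligible⇒≈ₙ[] (gonGo-x0-negligibleˢ k R ((refl ∷ []) , nonEmpty) one-X0Power))
        (gonGo-x0-≈ₙ-𝟙⊗word k (R ∷ʳ x0))

gonGo-x1-≈ₙ-word⊗𝟙 : ∀ k {seg} → X0Power⁺ seg → gonGo x1 seg one [] (x0^ k x1) ≈ₙ (1ℚ , seg ++ x0^ k x1 , []) ∷ []
gonGo-x1-≈ₙ-word⊗𝟙 zero    {_ ∷ _} _ = modNegligible [] [] λ a b → refl
gonGo-x1-≈ₙ-word⊗𝟙 (suc k) {seg} ps@(p , _) rewrite sym (++-assoc seg (x0 ∷ []) (x0^ k x1)) =
  ≈ₙ-++ (gonGo-x1-≈ₙ-word⊗𝟙 k (++⁺ p (refl ∷ []) , NonEmpty-∷ʳ seg x0))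
        (negligible⇒≈ₙ[] (gonGo-x0-negligibleᴸ k (x0 ∷ []) [] (ps ∷ [])))

ΔGon-zetaWord-≈ₙ : ∀ k → 2 ≤ k → ΔGon (zetaWord k) ≈ₙ (1ℚ , zetaWord k , []) ∷ (1ℚ , [] , zetaWord k) ∷ []
ΔGon-zetaWord-≈ₙ (suc (suc j)) (s≤s (s≤s z≤n)) =
  ≈ₙ-++ (gonGo-x1-≈ₙ-word⊗𝟙 j ((refl ∷ []) , nonEmpty)) (gonGo-x0-≈ₙ-𝟙⊗word j (x0 ∷ []))

coeff2-scaleT : ∀ c t a b → coeff2 (scaleT c t) a b ≡ c *ℚ coeff2 t a b
coeff2-scaleT c []                a b = sym (*-zeroʳ c)
coeff2-scaleT c ((d , u , v) ∷ t) a b rewrite coeff2-scaleT c t a b with eqW u a ∧ eqW v b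
... | true  = sym (*-distribˡ-+ c d (coeff2 t a b))
... | false = trans (+-identityˡ _) (cong (c *ℚ_) (sym (+-identityˡ _)))

coeff2-replicate : ∀ n d u v a b → coeff2 (replicate n (d , u , v)) a b ≡ coeff2 ((n ×ℚ d , u , v) ∷ []) a b
coeff2-replicate zero    d u v a b with eqW u a ∧ eqW v b
... | true  = refl
... | false = refl
coeff2-replicate (suc n) d u v a b rewrite coeff2-replicate n d u v a b with eqW u a ∧ eqW v b
... | true  = sym (+-assoc d (n ×ℚ d) 0ℚ)
... | false = refl

sh-x0-X0Power : ∀ {u} → X0Power u → sh (x0 ∷ []) u ≡ replicate (suc (length u)) (1ℚ , x0 ∷ u)
sh-x0-X0Power {[]}     []         = refl
sh-x0-X0Power {x0 ∷ u} (refl ∷ p) = cong ((1ℚ , x0 ∷ x0 ∷ u) ∷_) (begin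
  lmul x0 (sh (x0 ∷ []) u)                          ≡⟨ cong (lmul x0) (sh-x0-X0Power p) ⟩
  lmul x0 (replicate (suc (length u)) (1ℚ , x0 ∷ u)) ≡⟨ map-replicate _ (suc (length u)) _ ⟩
  replicate (suc (length u)) (1ℚ , x0 ∷ x0 ∷ u)     ∎)
  where open ≡-Reasoning

evalK-x0 : ∀ c {u} v → X0Power u → evalK (kl c (fromZ gx0) u v) ≡ replicate (suc (length u)) (c *ℚ 1ℚ , x0 ∷ u , v)
evalK-x0 c {u} v p rewrite sh-x0-X0Power p = maps-replicate (suc (length u))
  where
  open ≡-Reasoning
  maps-replicate : ∀ {F : ℚ × Word → ℚ × Word × Word} {G H : ℚ × Word → ℚ × Word} n {e} →
                   map F (map G ((map H (replicate n e) ++ []) ++ [])) ≡ replicate n (F (G (H e)))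
  maps-replicate {F} {G} {H} n {e} = begin
    map F (map G ((map H (replicate n e) ++ []) ++ [])) ≡⟨ cong (map F ∘ map G) (trans (++-identityʳ _) (++-identityʳ _)) ⟩
    map F (map G (map H (replicate n e)))              ≡⟨ cong (map F ∘ map G) (map-replicate H n e) ⟩
    map F (map G (replicate n (H e)))                  ≡⟨ cong (map F) (map-replicate G n (H e)) ⟩
    map F (replicate n (G (H e)))                      ≡⟨ map-replicate F n (G (H e)) ⟩
    replicate n (F (G (H e)))                          ∎

suc×1ℚ-nonZero : ∀ m → NonZero (suc m ×ℚ 1ℚ)
suc×1ℚ-nonZero m = pos⇒nonZero (suc m ×ℚ 1ℚ) {{pos+nonNeg⇒pos 1ℚ (m ×ℚ 1ℚ) {{×1ℚ-nonNegative m}}}}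
  where
  ×1ℚ-nonNegative : ∀ m → NonNegative (m ×ℚ 1ℚ)
  ×1ℚ-nonNegative zero    = _
  ×1ℚ-nonNegative (suc m) = nonNeg+nonNeg⇒nonNeg 1ℚ (m ×ℚ 1ℚ) {{×1ℚ-nonNegative m}}

×ℚ-cancel : ∀ m c → suc m ×ℚ (c *ℚ (1/ (suc m ×ℚ 1ℚ)) {{suc×1ℚ-nonZero m}}) ≡ c
×ℚ-cancel m c = begin
  n ×ℚ (c *ℚ i)    ≡⟨ ×-comm-* n c i ⟨
  c *ℚ (n ×ℚ i)    ≡⟨ cong (λ x → c *ℚ (n ×ℚ x)) (*-identityˡ i) ⟨
  c *ℚ (n ×ℚ (1ℚ *ℚ i)) ≡⟨ cong (c *ℚ_) (×-assoc-* n 1ℚ i) ⟨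
  c *ℚ (q *ℚ i)    ≡⟨ cong (c *ℚ_) (*-inverseʳ q {{suc×1ℚ-nonZero m}}) ⟩
  c *ℚ 1ℚ          ≡⟨ *-identityʳ c ⟩
  c                ∎
  where
  open ≡-Reasoning
  n = suc m
  q = n ×ℚ 1ℚ
  i = (1/ q) {{suc×1ℚ-nonZero m}}

-- c·x0^(m+1) ⊗ v is c/(m+1) times the spanning element (x0 ⧢ x0^m) ⊗ v.
x0-monomial-inKernel : ∀ c {u} v → X0Power u → Σ KTerm λ k → evalK k ≈ (c , x0 ∷ u , v) ∷ []
x0-monomial-inKernel c {u} v p = kl c′ (fromZ gx0) u v , λ a b → begin
  coeff2 (evalK (kl c′ (fromZ gx0) u v)) a b             ≡⟨ cong (λ t → coeff2 t a b) (evalK-x0 c′ v p) ⟩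
  coeff2 (replicate (suc m) (c′ *ℚ 1ℚ , x0 ∷ u , v)) a b ≡⟨ coeff2-replicate (suc m) (c′ *ℚ 1ℚ) (x0 ∷ u) v a b ⟩
  coeff2 ((suc m ×ℚ (c′ *ℚ 1ℚ) , x0 ∷ u , v) ∷ []) a b   ≡⟨ cong (λ d → coeff2 ((d , x0 ∷ u , v) ∷ []) a b) suc-m×c′≡c ⟩
  coeff2 ((c , x0 ∷ u , v) ∷ []) a b                     ∎
  where
  open ≡-Reasoning
  m  = length u
  c′ = c *ℚ (1/ (suc m ×ℚ 1ℚ)) {{suc×1ℚ-nonZero m}}
  suc-m×c′≡c : suc m ×ℚ (c′ *ℚ 1ℚ) ≡ c
  suc-m×c′≡c = trans (cong (suc m ×ℚ_) (*-identityʳ c′)) (×ℚ-cancel m c)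

InKer-∷ : ∀ {e g} → (Σ KTerm λ k → evalK k ≈ e ∷ []) → InKer g → InKer (e ∷ g)
InKer-∷ {e} {g} (k , ek) (ks , eks) = k ∷ ks , λ a b → begin
  coeff2 (e ∷ g) a b                                        ≡⟨ coeff2-++ (e ∷ []) g a b ⟩
  coeff2 (e ∷ []) a b +ℚ coeff2 g a b                        ≡⟨ cong₂ _+ℚ_ (ek a b) (sym (eks a b)) ⟨
  coeff2 (evalK k) a b +ℚ coeff2 (concatMap evalK ks) a b   ≡⟨ coeff2-++ (evalK k) (concatMap evalK ks) a b ⟨
  coeff2 (concatMap evalK (k ∷ ks)) a b                     ∎
  where open ≡-Reasoning

negligible⇒InKer : ∀ {g} → Negligible g → InKer g
negligible⇒InKer [] = [] , λ a b → refl
negligible⇒InKer {(c , _ ∷ u , v) ∷ g} ((refl ∷ p , nonEmpty) ∷ n) =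
  InKer-∷ {c , x0 ∷ u , v} {g} (x0-monomial-inKernel c v p) (negligible⇒InKer n)

≈ₙ⇒EqAZ : ∀ {t s} → t ≈ₙ s → EqAZ t s
≈ₙ⇒EqAZ {t} {s} (modNegligible g n e) with negligible⇒InKer n
... | ks , eg = ks , λ a b → begin
  coeff2 (t ++ scaleT (- 1ℚ) s) a b                          ≡⟨ coeff2-++ t _ a b ⟩
  coeff2 t a b +ℚ coeff2 (scaleT (- 1ℚ) s) a b               ≡⟨ cong₂ _+ℚ_ (trans (e a b) (coeff2-++ s g a b)) (coeff2-scaleT (- 1ℚ) s a b) ⟩
  (coeff2 s a b +ℚ coeff2 g a b) +ℚ (- 1ℚ) *ℚ coeff2 s a b   ≡⟨ cancel (coeff2 s a b) (coeff2 g a b) ⟩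
  coeff2 g a b                                               ≡⟨ eg a b ⟩
  coeff2 (concatMap evalK ks) a b                            ∎
  where
  open ≡-Reasoning
  open +-*-Solver
  cancel : ∀ x y → (x +ℚ y) +ℚ (- 1ℚ) *ℚ x ≡ y
  cancel = solve 2 (λ x y → (x :+ y) :+ con (- 1ℚ) :* x := y) refl

lemma5p43 : (n : ℕ) → 1 ≤ n →
    EqAZ (ΔGon (zetaWord (2 * n + 1)))
         ((1ℚ , zetaWord (2 * n + 1) , []) ∷ (1ℚ , [] , zetaWord (2 * n + 1)) ∷ [])
lemma5p43 n 1≤n = ≈ₙ⇒EqAZ (ΔGon-zetaWord-≈ₙ (2 * n + 1) 2≤2n+1)
  where
  2≤2n+1 : 2 ≤ 2 * n + 1
  2≤2n+1 = ≤-trans (s≤s (s≤s z≤n)) (+-monoˡ-≤ 1 (*-monoʳ-≤ 2 1≤n))
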